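{- In Single-delete Nim with $n\geq 2$ piles, the position $\langle 2,2,\ldots,2\rangle$ (all $n$ piles of size $2$) is an N-position if $n\equiv 2 \pmod 3$, and is a P-position otherwise.
   Context: Single-delete Nim with $n\geq 2$ piles: a position is $n$ piles of stones with positive sizes $\langle x_1,\ldots,x_n\rangle$. Two players alternate; a move consists of removing one pile entirely and then splitting one of the remaining $n-1$ piles into two piles each with at least one stone. A player unable to move loses. A P-position is one from which the player to move loses under optimal play by both players; an N-position is one from which the player to move can force a win. -}

module Defs where

open import Data.Nat using (ℕ; suc; _+_; _≤_)
open import Data.List using (List; []; _∷_)
open import Data.Product using (∃; _×_)

-- A position is a list of pile sizes (order is immaterial for the game;
-- moves below act in place).

data Remove : List ℕ → List ℕ → Set where
  here  : ∀ {x xs} → Remove (x ∷ xs) xs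
  there : ∀ {x xs ys} → Remove xs ys → Remove (x ∷ xs) (x ∷ ys)

data Split : List ℕ → List ℕ → Set where
  here  : ∀ {a b xs} → 1 ≤ a → 1 ≤ b → Split ((a + b) ∷ xs) (a ∷ b ∷ xs)
  there : ∀ {x xs ys} → Split xs ys → Split (x ∷ xs) (x ∷ ys)

Move : List ℕ → List ℕ → Set
Move p q = ∃ λ r → Remove p r × Split r q

-- N-positions (player to move can force a win) and P-positions (player to
-- move loses), defined inductively (the game is finite: total stones drop).
mutual
  data IsN (p : List ℕ) : Set where
    win : ∀ {q} → Move p q → IsP q → IsN p

  data IsP (p : List ℕ) : Set where
    lose : (∀ q → Move p q → IsN q) → IsP p

{-# OPTIONS --safe #-}
-- Every position reachable from ⟨2,…,2⟩ consists of piles of sizes 1 and 2,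
-- and only a 2 can be split, necessarily into 1 + 1. So a move deletes a 1 or
-- a 2 and splits a 2: the number t of 2s drops by 1 or 2, and the result
-- always contains a 1. Hence t ≡ 0 (mod 3) is a P-position, t ≡ 2 is an
-- N-position (delete a 2), and t ≡ 1 is an N-position when some 1 can be
-- deleted. ⟨2,…,2⟩ with t ≡ 1 has no 1, so its only moves delete a 2 and lead
-- to t ≡ 2: it is a P-position.
module Submission where

open import Defs
open import Data.Nat using (ℕ; zero; suc; _+_; _*_; _≤_; _%_; _/_; s≤s; z≤n)
open import Data.Nat.DivMod using (m≡m%n+[m/n]*n; m%n<n)
open import Data.Nat.Properties using (suc-injective; m+1+n≢0)
open import Data.List using (List; []; _∷_; replicate)
open import Data.Product using (_×_; _,_; ∃)
open import Relation.Binary.PropositionalEquality using (_≡_; _≢_; refl; subst)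
open import Relation.Nullary using (¬_; contradiction)

private variable
  p q r xs : List ℕ
  a b x o t : ℕ

infixr 5 one∷_ two∷_

data OnesTwos : List ℕ → ℕ → ℕ → Set where
  []    : OnesTwos [] 0 0
  one∷_ : OnesTwos xs o t → OnesTwos (1 ∷ xs) (suc o) t
  two∷_ : OnesTwos xs o t → OnesTwos (2 ∷ xs) o (suc t)

replicate-twos : ∀ n → OnesTwos (replicate n 2) 0 n
replicate-twos zero    = []
replicate-twos (suc n) = two∷ (replicate-twos n)

halves-of-two : 1 ≤ a → 1 ≤ b → a + b ≡ 2 → a ≡ 1 × b ≡ 1
halves-of-two {1}           {1}           _ _ _  = refl , refl
halves-of-two {1}           {suc (suc _)} _ _ ()
halves-of-two {suc (suc a)} {suc _}       _ _ eq =
  contradiction (suc-injective (suc-injective eq)) (m+1+n≢0 a)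

data AfterRemove (r : List ℕ) : ℕ → ℕ → Set where
  one-removed : OnesTwos r o t → AfterRemove r (suc o) t
  two-removed : OnesTwos r o t → AfterRemove r o (suc t)

data AfterSplit (q : List ℕ) : ℕ → ℕ → Set where
  two-split : OnesTwos q (2 + o) t → AfterSplit q o (suc t)

data AfterMove (q : List ℕ) : ℕ → ℕ → Set where
  one-deleted : OnesTwos q (2 + o) t → AfterMove q (suc o) (suc t)
  two-deleted : OnesTwos q (2 + o) t → AfterMove q o (2 + t)

remove-ones-twos : OnesTwos p o t → Remove p r → AfterRemove r o t
remove-ones-twos (one∷ s) here = one-removed s
remove-ones-twos (two∷ s) here = two-removed s
remove-ones-twos (one∷ s) (there rm) with remove-ones-twos s rm
... | one-removed s′ = one-removed (one∷ s′)
... | two-removed s′ = two-removed (one∷ s′)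
remove-ones-twos (two∷ s) (there rm) with remove-ones-twos s rm
... | one-removed s′ = one-removed (two∷ s′)
... | two-removed s′ = two-removed (two∷ s′)

-- The pile size is generalised to x: Agda cannot unify a + b with 1 or 2.
split-pile : 1 ≤ a → 1 ≤ b → a + b ≡ x → OnesTwos (x ∷ xs) o t → AfterSplit (a ∷ b ∷ xs) o t
split-pile (s≤s z≤n) (s≤s z≤n) a+b≡1 (one∷ _) =
  contradiction (suc-injective a+b≡1) (m+1+n≢0 _)
split-pile 1≤a 1≤b a+b≡2 (two∷ s) with refl , refl ← halves-of-two 1≤a 1≤b a+b≡2 =
  two-split (one∷ one∷ s)

split-ones-twos : OnesTwos r o t → Split r q → AfterSplit q o t
split-ones-twos s (here 1≤a 1≤b) = split-pile 1≤a 1≤b refl s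
split-ones-twos (one∷ s) (there sp) with split-ones-twos s sp
... | two-split s′ = two-split (one∷ s′)
split-ones-twos (two∷ s) (there sp) with split-ones-twos s sp
... | two-split s′ = two-split (two∷ s′)

move-ones-twos : OnesTwos p o t → Move p q → AfterMove q o t
move-ones-twos s (_ , rm , sp) with remove-ones-twos s rm
... | one-removed s′ with split-ones-twos s′ sp
...   | two-split s″ = one-deleted s″
move-ones-twos s (_ , rm , sp) | two-removed s′ with split-ones-twos s′ sp
...   | two-split s″ = two-deleted s″

remove-a-one : OnesTwos p (suc o) t → ∃ λ r → Remove p r × OnesTwos r o t
remove-a-one (one∷ s) = _ , here , s
remove-a-one (two∷ s) with r , rm , s′ ← remove-a-one s = 2 ∷ r , there rm , two∷ s′

remove-a-two : OnesTwos p o (suc t) → ∃ λ r → Remove p r × OnesTwos r o t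
remove-a-two (two∷ s) = _ , here , s
remove-a-two (one∷ s) with r , rm , s′ ← remove-a-two s = 1 ∷ r , there rm , one∷ s′

split-a-two : OnesTwos r o (suc t) → ∃ λ q → Split r q × OnesTwos q (2 + o) t
split-a-two (two∷ s) = _ , here {1} {1} (s≤s z≤n) (s≤s z≤n) , one∷ one∷ s
split-a-two (one∷ s) with q , sp , s′ ← split-a-two s = 1 ∷ q , there sp , one∷ s′

mutual
  3m-twos⇒P : ∀ m → OnesTwos p o (m * 3) → IsP p
  3m-twos⇒P m s = lose λ q mv → after-3m-twos⇒N m (move-ones-twos s mv)

  after-3m-twos⇒N : ∀ m → AfterMove q o (m * 3) → IsN q
  after-3m-twos⇒N (suc m) (one-deleted s) = 3m+2-twos⇒N m s
  after-3m-twos⇒N (suc m) (two-deleted s) = 3m+1-twos-and-a-one⇒N m s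

  removal-to-3m+1-twos-and-a-one⇒N : ∀ m → Remove p r → OnesTwos r o (suc (m * 3)) → IsN p
  removal-to-3m+1-twos-and-a-one⇒N m rm s with q , sp , s′ ← split-a-two s =
    win (_ , rm , sp) (3m-twos⇒P m s′)

  3m+1-twos-and-a-one⇒N : ∀ m → OnesTwos p (suc o) (suc (m * 3)) → IsN p
  3m+1-twos-and-a-one⇒N m s with r , rm , s′ ← remove-a-one s = removal-to-3m+1-twos-and-a-one⇒N m rm s′

  3m+2-twos⇒N : ∀ m → OnesTwos p o (2 + m * 3) → IsN p
  3m+2-twos⇒N m s with r , rm , s′ ← remove-a-two s = removal-to-3m+1-twos-and-a-one⇒N m rm s′

after-3m+1-twos-only⇒N : ∀ m → AfterMove q 0 (suc (m * 3)) → IsN q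
after-3m+1-twos-only⇒N (suc m) (two-deleted s) = 3m+2-twos⇒N m s

3m+1-twos-only⇒P : ∀ m → OnesTwos p 0 (suc (m * 3)) → IsP p
3m+1-twos-only⇒P m s = lose λ q mv → after-3m+1-twos-only⇒N m (move-ones-twos s mv)

twos-only-outcome : ∀ t → OnesTwos p 0 t → (t % 3 ≡ 2 → IsN p) × (t % 3 ≢ 2 → IsP p)
twos-only-outcome {p} t s with t % 3 | m≡m%n+[m/n]*n t 3 | m%n<n t 3
... | 0 | t≡3m   | _ = (λ ()) , λ _ → 3m-twos⇒P (t / 3) (subst (OnesTwos p 0) t≡3m s)
... | 1 | t≡3m+1 | _ = (λ ()) , λ _ → 3m+1-twos-only⇒P (t / 3) (subst (OnesTwos p 0) t≡3m+1 s)
... | 2 | t≡3m+2 | _ =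
  (λ _ → 3m+2-twos⇒N (t / 3) (subst (OnesTwos p 0) t≡3m+2 s)) , λ t%3≢2 → contradiction refl t%3≢2
... | suc (suc (suc _)) | _ | s≤s (s≤s (s≤s ()))

proposition4p2 : (n : ℕ) → 2 ≤ n →
    (n % 3 ≡ 2 → IsN (replicate n 2)) × (¬ (n % 3 ≡ 2) → IsP (replicate n 2))
proposition4p2 n _ = twos-only-outcome n (replicate-twos n)
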